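{- Let $\Phi = \mathcal{Q} : (A \wedge B)$ be an SSAT formula, where $A$ and $B$ are propositional formulae. Let $V_A := \mathrm{Var}(A)\setminus \mathrm{Var}(B) = \{a_1,\dots,a_\alpha\}$, $V_B := \mathrm{Var}(B)\setminus\mathrm{Var}(A) = \{b_1,\dots,b_\beta\}$, $V_{A,B} := \mathrm{Var}(A)\cap\mathrm{Var}(B)$, and let $\mathcal{S}_{A,B}$ be a propositional formula with $\mathrm{Var}(\mathcal{S}_{A,B}) \subseteq V_{A,B}$ such that $\mathcal{S}_{A,B} \equiv \exists a_1,\dots,a_\alpha, b_1,\dots,b_\beta : (A\wedge B)$. Then a propositional formula $\mathcal{I}$ is a generalized Craig interpolant for $(A,B)$ if and only if all of the following hold: (1) $\mathrm{Var}(\mathcal{I}) \subseteq V_{A,B}$; (2) $Pr(\mathcal{Q} : (A \wedge \neg \mathcal{S}_{A,B} \wedge \neg\mathcal{I})) = 0$; (3) $Pr(\mathcal{Q} : (\mathcal{I} \wedge B \wedge \neg \mathcal{S}_{A,B})) = 0$.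
   Context: An SSAT (stochastic Boolean satisfiability) formula is $\Phi = \mathcal{Q} : \varphi$ where $\mathcal{Q} = Q_1x_1\ldots Q_nx_n$ is a prefix of quantified propositional variables, each $Q_i$ being either an existential quantifier $\exists$ or a randomized quantifier $\mathsf{R}^{p_i}$ with a rational constant $0<p_i<1$, and $\varphi$ is a propositional formula with $\mathrm{Var}(\varphi)\subseteq\{x_1,\dots,x_n\}$ ($\mathrm{Var}(\cdot)$ denotes the set of variables occurring in a formula). Its maximum probability of satisfaction $Pr$ is defined recursively: $Pr(\varepsilon:\varphi)$ is $0$ if $\varphi$ is logically equivalent to false and $1$ if it is logically equivalent to true (with $\varepsilon$ the empty prefix); $Pr(\exists x\,\mathcal{Q}' : \varphi) = \max(Pr(\mathcal{Q}':\varphi[\mathrm{true}/x]), Pr(\mathcal{Q}':\varphi[\mathrm{false}/x]))$; $Pr(\mathsf{R}^{p} x\,\mathcal{Q}' : \varphi) = p\cdot Pr(\mathcal{Q}':\varphi[\mathrm{true}/x]) + (1-p)\cdot Pr(\mathcal{Q}':\varphi[\mathrm{false}/x])$. For the formulae $\psi$ above, $Pr(\mathcal{Q}:\psi)$ is understood with $\mathrm{Var}(\psi)$ contained in the variables of $\mathcal{Q}$. Generalized Craig interpolant: with $V_A, V_B, V_{A,B}$ as in the claim, $A^{\exists} := \exists a_1,\dots,a_\alpha : A$ and $\overline{B}^{\forall} := \neg\exists b_1,\dots,b_\beta : B$, a propositional formula $\mathcal{I}$ is a generalized Craig interpolant for $(A,B)$ iff $\mathrm{Var}(\mathcal{I})\subseteq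 V_{A,B}$, $(A^{\exists}\wedge\overline{B}^{\forall}) \Rightarrow \mathcal{I}$ is valid, and $\mathcal{I}\Rightarrow (A^{\exists}\vee\overline{B}^{\forall})$ is valid. -}

module Defs where

open import Data.Bool using (Bool; true; false; if_then_else_; _∧_; _∨_; not)
open import Data.Nat using (ℕ; _≟_)
open import Data.List using (List; []; _∷_; _++_; filter; map)
open import Data.List.Membership.DecPropositional _≟_ using (_∈_; _∈?_)
open import Data.List.Relation.Unary.Unique.Propositional using (Unique)
open import Data.Product using (_×_; _,_; proj₁)
open import Relation.Nullary.Decidable using (¬?; yes; no)
open import Relation.Binary.PropositionalEquality using (_≡_)
open import Data.Rational using (ℚ; 0ℚ; 1ℚ; _+_; _*_; _-_; _⊔_; _<_)

Var : Set
Var = ℕ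

data Form : Set where
  ⊤f ⊥f : Form
  var   : Var → Form
  ¬f_   : Form → Form
  _∧f_  : Form → Form → Form
  _∨f_  : Form → Form → Form

infixr 6 _∧f_
infixr 5 _∨f_
infix  7 ¬f_

vars : Form → List Var
vars ⊤f = []
vars ⊥f = []
vars (var x) = x ∷ []
vars (¬f φ) = vars φ
vars (φ ∧f ψ) = vars φ ++ vars ψ
vars (φ ∨f ψ) = vars φ ++ vars ψ

_occursIn_ : Var → Form → Set
x occursIn φ = x ∈ vars φ

Assignment : Set
Assignment = Var → Bool

eval : Assignment → Form → Bool
eval σ ⊤f = true
eval σ ⊥f = false
eval σ (var x) = σ x
eval σ (¬f φ) = not (eval σ φ)
eval σ (φ ∧f ψ) = eval σ φ ∧ eval σ ψ
eval σ (φ ∨f ψ) = eval σ φ ∨ eval σ ψ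

bconst : Bool → Form
bconst true = ⊤f
bconst false = ⊥f

subst : Var → Bool → Form → Form
subst x b ⊤f = ⊤f
subst x b ⊥f = ⊥f
subst x b (var y) with x ≟ y
... | yes _ = bconst b
... | no _ = var y
subst x b (¬f φ) = ¬f subst x b φ
subst x b (φ ∧f ψ) = subst x b φ ∧f subst x b ψ
subst x b (φ ∨f ψ) = subst x b φ ∨f subst x b ψ

Valid : Form → Set
Valid φ = ∀ (σ : Assignment) → eval σ φ ≡ true

_⇒f_ : Form → Form → Form
φ ⇒f ψ = ¬f φ ∨f ψ

_≡f_ : Form → Form → Set
φ ≡f ψ = ∀ (σ : Assignment) → eval σ φ ≡ eval σ ψ

exists : List Var → Form → Form
exists [] φ = φ
exists (x ∷ xs) φ = subst x true (exists xs φ) ∨f subst x false (exists xs φ)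

data Quant : Set where
  E : Quant
  R : (p : ℚ) → 0ℚ < p → p < 1ℚ → Quant

Prefix : Set
Prefix = List (Var × Quant)

prefixVars : Prefix → List Var
prefixVars = map proj₁

WellFormed : Prefix → Form → Set
WellFormed Q φ = Unique (prefixVars Q) × (∀ x → x occursIn φ → x ∈ prefixVars Q)

-- Maximum probability of satisfaction.  With the empty prefix the formula is
-- closed (given WellFormed), so it is equivalent to true iff it evaluates to
-- true (under any assignment).
Pr : Prefix → Form → ℚ
Pr [] φ = if eval (λ _ → false) φ then 1ℚ else 0ℚ
Pr ((x , E) ∷ Q) φ = Pr Q (subst x true φ) ⊔ Pr Q (subst x false φ)
Pr ((x , R p _ _) ∷ Q) φ = (p * Pr Q (subst x true φ)) + ((1ℚ - p) * Pr Q (subst x false φ))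

VA : Form → Form → List Var
VA A B = filter (λ x → ¬? (x ∈? vars B)) (vars A)

VB : Form → Form → List Var
VB A B = filter (λ x → ¬? (x ∈? vars A)) (vars B)

InVAB : Form → Form → Var → Set
InVAB A B x = (x occursIn A) × (x occursIn B)

GenInterpolant : Form → Form → Form → Set
GenInterpolant A B I =
  (∀ x → x occursIn I → InVAB A B x)
  × Valid ((exists (VA A B) A ∧f ¬f exists (VB A B) B) ⇒f I)
  × Valid (I ⇒f (exists (VA A B) A ∨f ¬f exists (VB A B) B))

-- S is equivalent to (∃V_A. A) ∧ (∃V_B. B), because A contains no variable of V_B and B none
-- of V_A. As S and I mention only shared variables, the first interpolant condition
-- (∃V_A. A) ∧ ¬(∃V_B. B) ⇒ I is equivalent to (∃V_A. A) ⇒ S ∨ I, and eliminating the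
-- quantifier to A ⇒ S ∨ I, i.e. to the unsatisfiability of A ∧ ¬S ∧ ¬I; symmetrically the
-- second condition amounts to the unsatisfiability of I ∧ B ∧ ¬S. Finally, for a formula
-- whose variables are bound by the prefix, Pr vanishes iff the formula is unsatisfiable:
-- both quantifiers combine the two cofactors with positive weight (max, or p and 1 − p).

module Submission where

open import Defs
open import Data.Product using (_×_)
open import Function.Bundles using (_⇔_)
open import Data.Rational using (0ℚ)
open import Relation.Binary.PropositionalEquality using (_≡_)
open import Data.List using (_++_)

open import Level using (0ℓ)
open import Function.Base using (_∘_; id)
open import Function.Bundles using (mk⇔; Equivalence)
open import Function.Properties.Equivalence using (⇔-setoid) renaming (trans to ⇔-trans; sym to ⇔-sym)
open import Data.Bool using (Bool; true; false; not; _∧_; _∨_)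
open import Data.Bool.Properties
  using (not-involutive; ∧-comm; ∧-identityʳ; ∧-distribˡ-∨; ∨-identityʳ; ∨-zeroʳ)
open import Data.Nat using (_≟_)
open import Data.List using (List; []; _∷_)
open import Data.List.Relation.Unary.Any using (here; there)
open import Data.List.Membership.DecPropositional _≟_ using (_∈_; _∉_; _∈?_)
open import Data.List.Membership.Propositional.Properties using (∈-++⁺ˡ; ∈-++⁺ʳ; ∈-++⁻; ∈-filter⁻)
open import Data.List.Relation.Binary.Subset.Propositional using (_⊆_)
open import Data.List.Relation.Binary.Disjoint.Propositional using (Disjoint; contractₗ)
open import Data.Product using (_,_; proj₁; proj₂)
open import Data.Sum using (inj₁; inj₂; [_,_])
open import Relation.Nullary using (yes; no; contradiction)
open import Relation.Nullary.Decidable using (¬?)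
open import Relation.Binary.PropositionalEquality
  using (_≢_; refl; sym; trans; cong; cong₂; module ≡-Reasoning)
import Relation.Binary.PropositionalEquality as ≡
import Relation.Binary.Reasoning.Setoid as SetoidReasoning
open import Data.Rational using (ℚ; 1ℚ; _*_; _+_; _-_; -_; _<_; Positive; NonNegative; positive; nonNegative)
open import Data.Rational.Properties
  using (positive⁻¹; nonNegative⁻¹; pos⇒nonNeg; pos*pos⇒pos; nonNeg*nonNeg⇒nonNeg;
         pos+nonNeg⇒pos; nonNeg+pos⇒pos; nonNeg+nonNeg⇒nonNeg;
         <-≤-trans; ≤-trans; <-irrefl; p≤p⊔q; p≤q⊔p; +-inverseʳ; +-monoˡ-<; *-zeroʳ)

private
  variable
    x y : Var
    xs ys zs : List Var
    b : Bool
    σ τ : Assignment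
    φ ψ : Form

++-⊆ : xs ⊆ zs → ys ⊆ zs → xs ++ ys ⊆ zs
++-⊆ {xs} xs⊆zs ys⊆zs = [ xs⊆zs , ys⊆zs ] ∘ ∈-++⁻ xs

disjointʳ-⊆ : Disjoint xs ys → zs ⊆ ys → Disjoint xs zs
disjointʳ-⊆ xs#ys zs⊆ys (v∈xs , v∈zs) = xs#ys (v∈xs , zs⊆ys v∈zs)

disjoint-++ : Disjoint xs ys → Disjoint xs zs → Disjoint xs (ys ++ zs)
disjoint-++ {ys = ys} xs#ys xs#zs (v∈xs , v∈ys++zs) =
  [ xs#ys ∘ (v∈xs ,_) , xs#zs ∘ (v∈xs ,_) ] (∈-++⁻ ys v∈ys++zs)

-- Evaluation and substitution

_[_≔_] : Assignment → Var → Bool → Assignment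
(σ [ x ≔ b ]) y with x ≟ y
... | yes _ = b
... | no _ = σ y

[≔]-≢ : x ≢ y → (σ [ x ≔ b ]) y ≡ σ y
[≔]-≢ {x} {y} x≢y with x ≟ y
... | yes x≡y = contradiction x≡y x≢y
... | no _ = refl

[≔]-self : ∀ y → (σ [ x ≔ σ x ]) y ≡ σ y
[≔]-self {x = x} y with x ≟ y
... | yes refl = refl
... | no _ = refl

eval-cong : ∀ φ → (∀ {y} → y ∈ vars φ → σ y ≡ τ y) → eval σ φ ≡ eval τ φ
eval-cong ⊤f agree = refl
eval-cong ⊥f agree = refl
eval-cong (var x) agree = agree (here refl)
eval-cong (¬f φ) agree = cong not (eval-cong φ agree)
eval-cong (φ ∧f ψ) agree =
  cong₂ _∧_ (eval-cong φ (agree ∘ ∈-++⁺ˡ)) (eval-cong ψ (agree ∘ ∈-++⁺ʳ (vars φ)))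
eval-cong (φ ∨f ψ) agree =
  cong₂ _∨_ (eval-cong φ (agree ∘ ∈-++⁺ˡ)) (eval-cong ψ (agree ∘ ∈-++⁺ʳ (vars φ)))

eval-fresh : ∀ φ → x ∉ vars φ → eval (σ [ x ≔ b ]) φ ≡ eval σ φ
eval-fresh {x = x} {σ = σ} {b = b} φ x∉φ =
  eval-cong φ (λ y∈φ → [≔]-≢ {x = x} {σ = σ} {b = b} λ { refl → x∉φ y∈φ })

eval-bconst : ∀ b → eval σ (bconst b) ≡ b
eval-bconst true = refl
eval-bconst false = refl

eval-subst : ∀ φ → eval σ (subst x b φ) ≡ eval (σ [ x ≔ b ]) φ
eval-subst ⊤f = refl
eval-subst ⊥f = refl
eval-subst {x = x} {b} (var y) with x ≟ y
... | yes _ = eval-bconst b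
... | no _ = refl
eval-subst (¬f φ) = cong not (eval-subst φ)
eval-subst (φ ∧f ψ) = cong₂ _∧_ (eval-subst φ) (eval-subst ψ)
eval-subst (φ ∨f ψ) = cong₂ _∨_ (eval-subst φ) (eval-subst ψ)

eval-subst-self : ∀ φ → eval σ (subst x (σ x) φ) ≡ eval σ φ
eval-subst-self {σ = σ} {x = x} φ =
  trans (eval-subst φ) (eval-cong φ (λ {y} _ → [≔]-self {σ = σ} {x = x} y))

∈-vars-subst⁻ : ∀ φ → y ∈ vars (subst x b φ) → y ∈ vars φ × y ≢ x
∈-vars-subst⁻ ⊤f ()
∈-vars-subst⁻ ⊥f ()
∈-vars-subst⁻ {x = x} (var z) y∈ with x ≟ z
∈-vars-subst⁻ {b = true} (var z) () | yes _
∈-vars-subst⁻ {b = false} (var z) () | yes _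
∈-vars-subst⁻ (var z) (here refl) | no x≢z = here refl , x≢z ∘ sym
∈-vars-subst⁻ (¬f φ) y∈ = ∈-vars-subst⁻ φ y∈
∈-vars-subst⁻ {x = x} {b} (φ ∧f ψ) y∈ with ∈-++⁻ (vars (subst x b φ)) y∈
... | inj₁ y∈φ = let (y∈ , y≢x) = ∈-vars-subst⁻ φ y∈φ in ∈-++⁺ˡ y∈ , y≢x
... | inj₂ y∈ψ = let (y∈ , y≢x) = ∈-vars-subst⁻ ψ y∈ψ in ∈-++⁺ʳ (vars φ) y∈ , y≢x
∈-vars-subst⁻ {x = x} {b} (φ ∨f ψ) y∈ with ∈-++⁻ (vars (subst x b φ)) y∈
... | inj₁ y∈φ = let (y∈ , y≢x) = ∈-vars-subst⁻ φ y∈φ in ∈-++⁺ˡ y∈ , y≢x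
... | inj₂ y∈ψ = let (y∈ , y≢x) = ∈-vars-subst⁻ ψ y∈ψ in ∈-++⁺ʳ (vars φ) y∈ , y≢x

vars-subst⊆ : ∀ φ → vars φ ⊆ x ∷ xs → vars (subst x b φ) ⊆ xs
vars-subst⊆ φ φ⊆ y∈ with ∈-vars-subst⁻ φ y∈
... | y∈φ , y≢x with φ⊆ y∈φ
...   | here y≡x = contradiction y≡x y≢x
...   | there y∈xs = y∈xs

-- Boolean quantification

eval-exists-∷ : ∀ x xs φ → eval σ (exists (x ∷ xs) φ)
              ≡ eval (σ [ x ≔ true ]) (exists xs φ) ∨ eval (σ [ x ≔ false ]) (exists xs φ)
eval-exists-∷ x xs φ = cong₂ _∨_ (eval-subst (exists xs φ)) (eval-subst (exists xs φ))

exists-intro : ∀ xs φ → eval σ φ ≡ true → eval σ (exists xs φ) ≡ true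
exists-intro [] φ φσ = φσ
exists-intro {σ} (x ∷ xs) φ φσ with σ x | eval-subst-self {σ = σ} {x = x} (exists xs φ)
... | true | E≡ = cong (_∨ eval σ (subst x false (exists xs φ))) (trans E≡ (exists-intro xs φ φσ))
... | false | E≡ = trans (cong (eval σ (subst x true (exists xs φ)) ∨_) (trans E≡ (exists-intro xs φ φσ)))
                         (∨-zeroʳ _)

exists-++ : ∀ xs ys φ → exists (xs ++ ys) φ ≡ exists xs (exists ys φ)
exists-++ [] ys φ = refl
exists-++ (x ∷ xs) ys φ = cong (λ E → subst x true E ∨f subst x false E) (exists-++ xs ys φ)

exists-cong : ∀ xs → φ ≡f ψ → exists xs φ ≡f exists xs ψ
exists-cong [] φ≡ψ = φ≡ψ
exists-cong {φ} {ψ} (x ∷ xs) φ≡ψ σ = begin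
  eval σ (exists (x ∷ xs) φ)
    ≡⟨ eval-exists-∷ x xs φ ⟩
  eval (σ [ x ≔ true ]) (exists xs φ) ∨ eval (σ [ x ≔ false ]) (exists xs φ)
    ≡⟨ cong₂ _∨_ (exists-cong xs φ≡ψ _) (exists-cong xs φ≡ψ _) ⟩
  eval (σ [ x ≔ true ]) (exists xs ψ) ∨ eval (σ [ x ≔ false ]) (exists xs ψ)
    ≡⟨ eval-exists-∷ x xs ψ ⟨
  eval σ (exists (x ∷ xs) ψ) ∎
  where open ≡-Reasoning

vars-exists⊆ : ∀ xs φ → vars (exists xs φ) ⊆ vars φ
vars-exists⊆ [] φ = id
vars-exists⊆ (x ∷ xs) φ =
  ++-⊆ (vars-exists⊆ xs φ ∘ proj₁ ∘ ∈-vars-subst⁻ (exists xs φ))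
       (vars-exists⊆ xs φ ∘ proj₁ ∘ ∈-vars-subst⁻ (exists xs φ))

exists-∧ˡ : ∀ xs → Disjoint xs (vars φ) → exists xs (φ ∧f ψ) ≡f (φ ∧f exists xs ψ)
exists-∧ˡ [] xs#φ σ = refl
exists-∧ˡ {φ} {ψ} (x ∷ xs) xs#φ σ = begin
  eval σ (exists (x ∷ xs) (φ ∧f ψ))
    ≡⟨ eval-exists-∷ x xs (φ ∧f ψ) ⟩
  eval (σ [ x ≔ true ]) (exists xs (φ ∧f ψ)) ∨ eval (σ [ x ≔ false ]) (exists xs (φ ∧f ψ))
    ≡⟨ cong₂ _∨_ (cofactor true) (cofactor false) ⟩
  eval σ φ ∧ eval (σ [ x ≔ true ]) (exists xs ψ) ∨ eval σ φ ∧ eval (σ [ x ≔ false ]) (exists xs ψ)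
    ≡⟨ ∧-distribˡ-∨ (eval σ φ) _ _ ⟨
  eval σ φ ∧ (eval (σ [ x ≔ true ]) (exists xs ψ) ∨ eval (σ [ x ≔ false ]) (exists xs ψ))
    ≡⟨ cong (eval σ φ ∧_) (eval-exists-∷ x xs ψ) ⟨
  eval σ φ ∧ eval σ (exists (x ∷ xs) ψ) ∎
  where
  open ≡-Reasoning
  cofactor : ∀ b → eval (σ [ x ≔ b ]) (exists xs (φ ∧f ψ)) ≡ eval σ φ ∧ eval (σ [ x ≔ b ]) (exists xs ψ)
  cofactor b = trans (exists-∧ˡ xs (contractₗ xs#φ) (σ [ x ≔ b ]))
                     (cong (_∧ _) (eval-fresh φ λ x∈φ → xs#φ (here refl , x∈φ)))

exists-∧ʳ : ∀ xs → Disjoint xs (vars ψ) → exists xs (φ ∧f ψ) ≡f (exists xs φ ∧f ψ)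
exists-∧ʳ {ψ} {φ} xs xs#ψ σ = begin
  eval σ (exists xs (φ ∧f ψ))     ≡⟨ exists-cong xs (λ τ → ∧-comm (eval τ φ) (eval τ ψ)) σ ⟩
  eval σ (exists xs (ψ ∧f φ))     ≡⟨ exists-∧ˡ xs xs#ψ σ ⟩
  eval σ ψ ∧ eval σ (exists xs φ) ≡⟨ ∧-comm (eval σ ψ) _ ⟩
  eval σ (exists xs φ) ∧ eval σ ψ ∎
  where open ≡-Reasoning

exists-∧-separate : ∀ xs ys → Disjoint xs (vars ψ) → Disjoint ys (vars φ)
                  → exists (xs ++ ys) (φ ∧f ψ) ≡f (exists xs φ ∧f exists ys ψ)
exists-∧-separate {ψ} {φ} xs ys xs#ψ ys#φ σ = begin
  eval σ (exists (xs ++ ys) (φ ∧f ψ))     ≡⟨ cong (eval σ) (exists-++ xs ys (φ ∧f ψ)) ⟩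
  eval σ (exists xs (exists ys (φ ∧f ψ))) ≡⟨ exists-cong xs (exists-∧ˡ ys ys#φ) σ ⟩
  eval σ (exists xs (φ ∧f exists ys ψ))   ≡⟨ exists-∧ʳ xs (disjointʳ-⊆ xs#ψ (vars-exists⊆ ys ψ)) σ ⟩
  eval σ (exists xs φ ∧f exists ys ψ)     ∎
  where open ≡-Reasoning

∨-⇒ : ∀ a b c → not a ∨ c ≡ true → not b ∨ c ≡ true → not (a ∨ b) ∨ c ≡ true
∨-⇒ a b true _ _ = ∨-zeroʳ _
∨-⇒ false false false _ _ = refl

exists-⇒f : ∀ xs φ ψ → Disjoint xs (vars ψ) → Valid (φ ⇒f ψ) → Valid (exists xs φ ⇒f ψ)
exists-⇒f [] φ ψ _ φ⇒ψ = φ⇒ψ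
exists-⇒f (x ∷ xs) φ ψ xs#ψ φ⇒ψ σ =
  trans (cong (λ e → not e ∨ eval σ ψ) (eval-exists-∷ x xs φ))
        (∨-⇒ _ _ (eval σ ψ) (cofactor true) (cofactor false))
  where
  cofactor : ∀ b → not (eval (σ [ x ≔ b ]) (exists xs φ)) ∨ eval σ ψ ≡ true
  cofactor b = trans (cong (not (eval (σ [ x ≔ b ]) (exists xs φ)) ∨_)
                           (sym (eval-fresh ψ λ x∈ψ → xs#ψ (here refl , x∈ψ))))
                     (exists-⇒f xs φ ψ (contractₗ xs#ψ) φ⇒ψ (σ [ x ≔ b ]))

exists-⇒f⇔ : ∀ xs φ ψ → Disjoint xs (vars ψ) → Valid (exists xs φ ⇒f ψ) ⇔ Valid (φ ⇒f ψ)
exists-⇒f⇔ xs φ ψ xs#ψ = mk⇔ weaken (exists-⇒f xs φ ψ xs#ψ)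
  where
  weaken : Valid (exists xs φ ⇒f ψ) → Valid (φ ⇒f ψ)
  weaken valid σ with eval σ φ in φσ
  ... | false = refl
  ... | true = trans (cong (λ e → not e ∨ eval σ ψ) (sym (exists-intro xs φ φσ))) (valid σ)

-- Probability of satisfaction

Unsatisfiable : Form → Set
Unsatisfiable φ = Valid (¬f φ)

module _ {p : ℚ} (0<p : 0ℚ < p) (p<1 : p < 1ℚ) {a c : ℚ} where

  private instance
    p-pos : Positive p
    p-pos = positive 0<p

    1-p-pos : Positive (1ℚ - p)
    1-p-pos = positive (≡.subst (_< 1ℚ - p) (+-inverseʳ p) (+-monoˡ-< (- p) p<1))

    p-nonNeg : NonNegative p
    p-nonNeg = pos⇒nonNeg p

    1-p-nonNeg : NonNegative (1ℚ - p)
    1-p-nonNeg = pos⇒nonNeg (1ℚ - p)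

  convex-nonNeg : .{{NonNegative a}} → .{{NonNegative c}} → NonNegative (p * a + (1ℚ - p) * c)
  convex-nonNeg = nonNeg+nonNeg⇒nonNeg (p * a) {{nonNeg*nonNeg⇒nonNeg p a}}
                                       ((1ℚ - p) * c) {{nonNeg*nonNeg⇒nonNeg (1ℚ - p) c}}

  convex-posˡ : .{{Positive a}} → .{{NonNegative c}} → Positive (p * a + (1ℚ - p) * c)
  convex-posˡ = pos+nonNeg⇒pos (p * a) {{pos*pos⇒pos p a}} ((1ℚ - p) * c) {{nonNeg*nonNeg⇒nonNeg (1ℚ - p) c}}

  convex-posʳ : .{{NonNegative a}} → .{{Positive c}} → Positive (p * a + (1ℚ - p) * c)
  convex-posʳ = nonNeg+pos⇒pos (p * a) {{nonNeg*nonNeg⇒nonNeg p a}} ((1ℚ - p) * c) {{pos*pos⇒pos (1ℚ - p) c}}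

Pr-nonNegative : ∀ Q φ → NonNegative (Pr Q φ)
Pr-nonNegative [] φ with eval (λ _ → false) φ
... | true = _
... | false = _
Pr-nonNegative ((x , E) ∷ Q) φ =
  nonNegative (≤-trans (nonNegative⁻¹ (Pr Q (subst x true φ)) {{Pr-nonNegative Q (subst x true φ)}})
                       (p≤p⊔q _ (Pr Q (subst x false φ))))
Pr-nonNegative ((x , R p 0<p p<1) ∷ Q) φ =
  convex-nonNeg 0<p p<1 {{Pr-nonNegative Q (subst x true φ)}} {{Pr-nonNegative Q (subst x false φ)}}

Pr-∷-positive : ∀ Q q b → Positive (Pr Q (subst x b φ)) → Positive (Pr ((x , q) ∷ Q) φ)
Pr-∷-positive {x} {φ} Q E true pos =
  positive (<-≤-trans (positive⁻¹ (Pr Q (subst x true φ)) {{pos}}) (p≤p⊔q _ (Pr Q (subst x false φ))))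
Pr-∷-positive {x} {φ} Q E false pos =
  positive (<-≤-trans (positive⁻¹ (Pr Q (subst x false φ)) {{pos}}) (p≤q⊔p (Pr Q (subst x true φ)) _))
Pr-∷-positive {x} {φ} Q (R p 0<p p<1) true pos =
  convex-posˡ 0<p p<1 {{pos}} {{Pr-nonNegative Q (subst x false φ)}}
Pr-∷-positive {x} {φ} Q (R p 0<p p<1) false pos =
  convex-posʳ 0<p p<1 {{Pr-nonNegative Q (subst x true φ)}} {{pos}}

Pr-positive : ∀ Q φ → vars φ ⊆ prefixVars Q → eval σ φ ≡ true → Positive (Pr Q φ)
Pr-positive {σ} [] φ closed φσ
  with eval (λ _ → false) φ | eval-cong {σ = σ} {τ = λ _ → false} φ (λ y∈φ → contradiction (closed y∈φ) λ ())
... | true | _ = _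
... | false | φσ≡false = contradiction (trans (sym φσ) φσ≡false) λ ()
Pr-positive {σ} ((x , q) ∷ Q) φ closed φσ =
  Pr-∷-positive Q q (σ x)
    (Pr-positive Q (subst x (σ x) φ) (vars-subst⊆ φ closed) (trans (eval-subst-self φ) φσ))

unsatisfiable-subst : ∀ φ → Unsatisfiable φ → Unsatisfiable (subst x b φ)
unsatisfiable-subst {x} {b} φ unsat σ = trans (cong not (eval-subst φ)) (unsat (σ [ x ≔ b ]))

Pr-unsatisfiable : ∀ Q φ → Unsatisfiable φ → Pr Q φ ≡ 0ℚ
Pr-unsatisfiable [] φ unsat with eval (λ _ → false) φ | unsat (λ _ → false)
... | false | _ = refl
Pr-unsatisfiable ((x , E) ∷ Q) φ unsat
  rewrite Pr-unsatisfiable Q (subst x true φ) (unsatisfiable-subst φ unsat)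
        | Pr-unsatisfiable Q (subst x false φ) (unsatisfiable-subst φ unsat) = refl
Pr-unsatisfiable ((x , R p _ _) ∷ Q) φ unsat
  rewrite Pr-unsatisfiable Q (subst x true φ) (unsatisfiable-subst φ unsat)
        | Pr-unsatisfiable Q (subst x false φ) (unsatisfiable-subst φ unsat)
        | *-zeroʳ p | *-zeroʳ (1ℚ - p) = refl

Pr≡0⇔unsatisfiable : ∀ Q φ → vars φ ⊆ prefixVars Q → Pr Q φ ≡ 0ℚ ⇔ Unsatisfiable φ
Pr≡0⇔unsatisfiable Q φ closed = mk⇔ unsatisfiable (Pr-unsatisfiable Q φ)
  where
  unsatisfiable : Pr Q φ ≡ 0ℚ → Unsatisfiable φ
  unsatisfiable Pr≡0 σ with eval σ φ in φσ
  ... | false = refl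
  ... | true = contradiction (positive⁻¹ _ {{Pr-positive Q φ closed φσ}}) (<-irrefl (sym Pr≡0))

-- The interpolant conditions

Valid-cong : ∀ φ ψ → φ ≡f ψ → Valid φ ⇔ Valid ψ
Valid-cong _ _ φ≡ψ =
  mk⇔ (λ valid σ → trans (sym (φ≡ψ σ)) (valid σ)) (λ valid σ → trans (φ≡ψ σ) (valid σ))

module _ (α β γ δ : Form) (δ≡α∧β : δ ≡f (α ∧f β)) where

  ⇒f-shiftˡ : Valid ((α ∧f ¬f β) ⇒f γ) ⇔ Valid (α ⇒f (δ ∨f γ))
  ⇒f-shiftˡ = Valid-cong ((α ∧f ¬f β) ⇒f γ) (α ⇒f (δ ∨f γ)) λ σ →
    trans (identity (eval σ α) (eval σ β) (eval σ γ))
          (cong (λ d → not (eval σ α) ∨ (d ∨ eval σ γ)) (sym (δ≡α∧β σ)))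
    where
    identity : ∀ a b c → not (a ∧ not b) ∨ c ≡ not a ∨ (a ∧ b ∨ c)
    identity true b c = cong (_∨ c) (not-involutive b)
    identity false b c = refl

  ⇒f-shiftʳ : Valid (γ ⇒f (α ∨f ¬f β)) ⇔ Valid (β ⇒f (¬f γ ∨f δ))
  ⇒f-shiftʳ = Valid-cong (γ ⇒f (α ∨f ¬f β)) (β ⇒f (¬f γ ∨f δ)) λ σ →
    trans (identity (eval σ α) (eval σ β) (eval σ γ))
          (cong (λ d → not (eval σ β) ∨ (not (eval σ γ) ∨ d)) (sym (δ≡α∧β σ)))
    where
    identity : ∀ a b c → not c ∨ (a ∨ not b) ≡ not b ∨ (not c ∨ a ∧ b)
    identity a b false = sym (∨-zeroʳ (not b))
    identity a true true = trans (∨-identityʳ a) (sym (∧-identityʳ a))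
    identity a false true = ∨-zeroʳ a

module _ (α β γ : Form) where

  ⇒f-∨⇔unsatisfiable : Valid (α ⇒f (β ∨f γ)) ⇔ Unsatisfiable (α ∧f ¬f β ∧f ¬f γ)
  ⇒f-∨⇔unsatisfiable = Valid-cong (α ⇒f (β ∨f γ)) (¬f (α ∧f ¬f β ∧f ¬f γ)) λ σ →
    identity (eval σ α) (eval σ β) (eval σ γ)
    where
    identity : ∀ a b c → not a ∨ (b ∨ c) ≡ not (a ∧ not b ∧ not c)
    identity true true c = refl
    identity true false c = sym (not-involutive c)
    identity false b c = refl

  ⇒f-¬∨⇔unsatisfiable : Valid (β ⇒f (¬f γ ∨f α)) ⇔ Unsatisfiable (γ ∧f β ∧f ¬f α)
  ⇒f-¬∨⇔unsatisfiable = Valid-cong (β ⇒f (¬f γ ∨f α)) (¬f (γ ∧f β ∧f ¬f α)) λ σ →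
    identity (eval σ α) (eval σ β) (eval σ γ)
    where
    identity : ∀ a b c → not b ∨ (not c ∨ a) ≡ not (c ∧ b ∧ not a)
    identity a b false = ∨-zeroʳ (not b)
    identity a false true = refl
    identity a true true = sym (not-involutive a)

module _ (S I : Form) where

  open SetoidReasoning (⇔-setoid 0ℓ)

  interpolant-left⇔ : ∀ xs A F → Disjoint xs (vars S) → Disjoint xs (vars I)
                    → S ≡f (exists xs A ∧f F)
                    → Valid ((exists xs A ∧f ¬f F) ⇒f I) ⇔ Unsatisfiable (A ∧f ¬f S ∧f ¬f I)
  interpolant-left⇔ xs A F xs#S xs#I S≡ = begin
    Valid ((exists xs A ∧f ¬f F) ⇒f I) ≈⟨ ⇒f-shiftˡ (exists xs A) F I S S≡ ⟩
    Valid (exists xs A ⇒f (S ∨f I))     ≈⟨ exists-⇒f⇔ xs A (S ∨f I) (disjoint-++ xs#S xs#I) ⟩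
    Valid (A ⇒f (S ∨f I))               ≈⟨ ⇒f-∨⇔unsatisfiable A S I ⟩
    Unsatisfiable (A ∧f ¬f S ∧f ¬f I)   ∎

  interpolant-right⇔ : ∀ ys B F → Disjoint ys (vars S) → Disjoint ys (vars I)
                     → S ≡f (F ∧f exists ys B)
                     → Valid (I ⇒f (F ∨f ¬f exists ys B)) ⇔ Unsatisfiable (I ∧f B ∧f ¬f S)
  interpolant-right⇔ ys B F ys#S ys#I S≡ = begin
    Valid (I ⇒f (F ∨f ¬f exists ys B)) ≈⟨ ⇒f-shiftʳ F (exists ys B) I S S≡ ⟩
    Valid (exists ys B ⇒f (¬f I ∨f S)) ≈⟨ exists-⇒f⇔ ys B (¬f I ∨f S) (disjoint-++ ys#I ys#S) ⟩
    Valid (B ⇒f (¬f I ∨f S))           ≈⟨ ⇒f-¬∨⇔unsatisfiable S B I ⟩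
    Unsatisfiable (I ∧f B ∧f ¬f S)     ∎

VA-disjoint : ∀ A B → Disjoint (VA A B) (vars B)
VA-disjoint A B (y∈VA , y∈B) = proj₂ (∈-filter⁻ (λ x → ¬? (x ∈? vars B)) {xs = vars A} y∈VA) y∈B

VB-disjoint : ∀ A B → Disjoint (VB A B) (vars A)
VB-disjoint A B (y∈VB , y∈A) = proj₂ (∈-filter⁻ (λ x → ¬? (x ∈? vars A)) {xs = vars B} y∈VB) y∈A

VA-disjoint-shared : ∀ A B F → (∀ x → x occursIn F → InVAB A B x) → Disjoint (VA A B) (vars F)
VA-disjoint-shared A B F F-shared = disjointʳ-⊆ (VA-disjoint A B) λ {y} y∈F → proj₂ (F-shared y y∈F)

VB-disjoint-shared : ∀ A B F → (∀ x → x occursIn F → InVAB A B x) → Disjoint (VB A B) (vars F)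
VB-disjoint-shared A B F F-shared = disjointʳ-⊆ (VB-disjoint A B) λ {y} y∈F → proj₁ (F-shared y y∈F)

exists-VA++VB : ∀ A B → exists (VA A B ++ VB A B) (A ∧f B) ≡f (exists (VA A B) A ∧f exists (VB A B) B)
exists-VA++VB A B = exists-∧-separate (VA A B) (VB A B) (VA-disjoint A B) (VB-disjoint A B)

lemma2p2 : (Q : Prefix) (A B S I : Form)
    → WellFormed Q (A ∧f B)
    → (∀ x → x occursIn S → InVAB A B x)
    → S ≡f exists (VA A B ++ VB A B) (A ∧f B)
    → GenInterpolant A B I
    ⇔ ((∀ x → x occursIn I → InVAB A B x)
    × Pr Q (A ∧f ¬f S ∧f ¬f I) ≡ 0ℚ
    × Pr Q (I ∧f B ∧f ¬f S) ≡ 0ℚ)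
lemma2p2 Q A B S I (_ , A∧B⊆Q) S-shared S≡ = mk⇔
  (λ (I-shared , I-left , I-right) → I-shared , to (left⇔ I-shared) I-left , to (right⇔ I-shared) I-right)
  (λ (I-shared , Pr₁≡0 , Pr₂≡0) → I-shared , from (left⇔ I-shared) Pr₁≡0 , from (right⇔ I-shared) Pr₂≡0)
  where
  open Equivalence using (to; from)

  A⊆Q : vars A ⊆ prefixVars Q
  A⊆Q y∈A = A∧B⊆Q _ (∈-++⁺ˡ y∈A)

  B⊆Q : vars B ⊆ prefixVars Q
  B⊆Q y∈B = A∧B⊆Q _ (∈-++⁺ʳ (vars A) y∈B)

  shared⊆Q : ∀ F → (∀ x → x occursIn F → InVAB A B x) → vars F ⊆ prefixVars Q
  shared⊆Q F F-shared {y} y∈F = A⊆Q (proj₁ (F-shared y y∈F))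

  S≡EA∧EB : S ≡f (exists (VA A B) A ∧f exists (VB A B) B)
  S≡EA∧EB σ = trans (S≡ σ) (exists-VA++VB A B σ)

  left⇔ : (∀ x → x occursIn I → InVAB A B x)
        → Valid ((exists (VA A B) A ∧f ¬f exists (VB A B) B) ⇒f I) ⇔ Pr Q (A ∧f ¬f S ∧f ¬f I) ≡ 0ℚ
  left⇔ I-shared =
    ⇔-trans (interpolant-left⇔ S I (VA A B) A (exists (VB A B) B)
               (VA-disjoint-shared A B S S-shared) (VA-disjoint-shared A B I I-shared) S≡EA∧EB)
            (⇔-sym (Pr≡0⇔unsatisfiable Q _
               (++-⊆ A⊆Q (++-⊆ (shared⊆Q S S-shared) (shared⊆Q I I-shared)))))

  right⇔ : (∀ x → x occursIn I → InVAB A B x)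
         → Valid (I ⇒f (exists (VA A B) A ∨f ¬f exists (VB A B) B)) ⇔ Pr Q (I ∧f B ∧f ¬f S) ≡ 0ℚ
  right⇔ I-shared =
    ⇔-trans (interpolant-right⇔ S I (VB A B) B (exists (VA A B) A)
               (VB-disjoint-shared A B S S-shared) (VB-disjoint-shared A B I I-shared) S≡EA∧EB)
            (⇔-sym (Pr≡0⇔unsatisfiable Q _
               (++-⊆ (shared⊆Q I I-shared) (++-⊆ B⊆Q (shared⊆Q S S-shared)))))
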